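{- For all positive integers $k,n$, it holds that $$s^{(m)}_{k,n} = a^{(m)}_{k,(n-1)k}.$$
   Context: A finite nonempty set $F\subset\mathbb{N}$ is called maximal Schreier if $\min F=|F|$. For $k,n\in\mathbb{N}$, let $s^{(m)}_{k,n}$ be the number of sets $F\subset\{k,2k,\ldots,nk\}$ such that $F$ is maximal Schreier and $nk\in F$. For $k\ge1$, define $(a^{(m)}_{k,n})_{n=0}^\infty$ by: $a^{(m)}_{k,0}=1$ if $k=1$ and $a^{(m)}_{k,0}=0$ if $k>1$; $a^{(m)}_{k,1}=0$; $a^{(m)}_{k,2}=1$; $a^{(m)}_{k,3}=\cdots=a^{(m)}_{k,k+1}=0$ (an empty list when $k=1$); and $a^{(m)}_{k,n}=a^{(m)}_{k,n-k}+a^{(m)}_{k,n-k-1}$ for $n\ge k+1$ (these prescriptions are consistent). -}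

module Defs where

open import Data.Nat using (ℕ; zero; suc; _+_; _*_; _∸_; _≡ᵇ_; _≤ᵇ_)
open import Data.Bool using (Bool; true; false; _∧_; if_then_else_)
open import Data.List using (List; []; _∷_; length; filter; map; _++_)
open import Data.Bool.ListAction using (any)
open import Data.Vec using (Vec; []; _∷_)
open import Data.Maybe using (Maybe; just; nothing)
open import Relation.Nullary.Decidable using (Dec)
open import Data.Bool.Properties using (T?)

allSubsets : (n : ℕ) → List (Vec Bool n)
allSubsets zero = [] ∷ []
allSubsets (suc n) = map (true ∷_) (allSubsets n) ++ map (false ∷_) (allSubsets n)

-- The set F ⊆ {k,2k,…,nk} described by a characteristic vector:
-- position i (0-based) being true means (i+1)*k ∈ F. Listed increasingly.
elemsFrom : {m : ℕ} → ℕ → ℕ → Vec Bool m → List ℕ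
elemsFrom k j [] = []
elemsFrom k j (true ∷ v) = j * k ∷ elemsFrom k (suc j) v
elemsFrom k j (false ∷ v) = elemsFrom k (suc j) v

multSet : {n : ℕ} → ℕ → Vec Bool n → List ℕ
multSet k v = elemsFrom k 1 v

minL : List ℕ → Maybe ℕ
minL [] = nothing
minL (x ∷ xs) with minL xs
... | nothing = just x
... | just m = just (if x ≤ᵇ m then x else m)

-- F (given as a duplicate-free list) is maximal Schreier: nonempty and min F = |F|
isMaxSchreier : List ℕ → Bool
isMaxSchreier F with minL F
... | nothing = false
... | just m = m ≡ᵇ length F

memberᵇ : ℕ → List ℕ → Bool
memberᵇ x F = any (λ y → y ≡ᵇ x) F

sm : ℕ → ℕ → ℕ
sm k n = length (filter (λ v → T? (isMaxSchreier (multSet k v) ∧ memberᵇ (n * k) (multSet k v)))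
                        (allSubsets n))

-- a^{(m)}_{k,n}, computed with fuel (fuel n+1 suffices since the index decreases)
aFuel : ℕ → ℕ → ℕ → ℕ
aFuel zero k n = 0
aFuel (suc f) k zero = if k ≡ᵇ 1 then 1 else 0
aFuel (suc f) k (suc zero) = 0
aFuel (suc f) k (suc (suc zero)) = 1
aFuel (suc f) k n@(suc (suc (suc _))) =
  if n ≤ᵇ suc k then 0 else aFuel f k (n ∸ k) + aFuel f k (n ∸ k ∸ 1)

am : ℕ → ℕ → ℕ
am k n = aFuel (suc n) k n

-- Classify a maximal Schreier set F ⊆ {k, …, nk} with nk ∈ F by its minimum jk. The other
-- elements are jk − 1 of the multiples (j+1)k, …, nk and include nk, so there are
-- tails (n − j) (jk − 1) of them, where tails L r (= binom(L−1, r−1) for L > 0) counts the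
-- r-element subsets of an L-element chain containing its top. Hence
-- s_{k,n} = Σ_L tails L (nk − 1 − Lk). By Pascal's rule for tails, the sums
-- Σ_L tails L (m + k − 1 − Lk) satisfy the initial values and the recurrence defining a_{k,m},
-- so they are a_{k,m}; taking m = (n − 1)k gives the theorem.
module Submission where

open import Defs
open import Data.Nat using (ℕ; _*_; _∸_; _≥_)
open import Relation.Binary.PropositionalEquality using (_≡_)

open import Data.Bool using (Bool; true; false; _∧_; _∨_; if_then_else_; T)
open import Data.Bool.Properties using (T?)
open import Data.List using (List; []; _∷_; length; filter; map; _++_)
open import Data.List.Properties using (filter-++; length-++; filter-none; filter-≐)
open import Data.List.Relation.Unary.All using (All; []; _∷_; universal)
open import Data.Maybe using (just; nothing)
import Data.Maybe.Relation.Unary.All as Maybe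
open import Data.Nat using (zero; suc; _+_; _≤_; _<_; _≡ᵇ_; _≤ᵇ_; z≤n; s≤s; z<s; _≟_)
open import Data.Nat.Properties
open import Data.Product using (_,_)
open import Data.Unit using (tt)
open import Data.Vec using (Vec; []; _∷_; countᵇ)
open import Function using (_∘_; id)
open import Relation.Binary.PropositionalEquality using (refl; sym; trans; cong; cong₂; subst; module ≡-Reasoning)
open import Relation.Nullary.Decidable using (dec-true; dec-false)
open import Algebra.Properties.CommutativeSemigroup +-commutativeSemigroup
  using (interchange; x∙yz≈y∙xz)

open ≡-Reasoning

∑< : ℕ → (ℕ → ℕ) → ℕ
∑< zero    f = 0
∑< (suc N) f = f N + ∑< N f

∑<-cong : ∀ N {f g : ℕ → ℕ} → (∀ L → f L ≡ g L) → ∑< N f ≡ ∑< N g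
∑<-cong zero    f≗g = refl
∑<-cong (suc N) f≗g = cong₂ _+_ (f≗g N) (∑<-cong N f≗g)

∑<-+ : ∀ N (f g : ℕ → ℕ) → ∑< N (λ L → f L + g L) ≡ ∑< N f + ∑< N g
∑<-+ zero    f g = refl
∑<-+ (suc N) f g = trans (cong (f N + g N +_) (∑<-+ N f g)) (interchange (f N) (g N) (∑< N f) (∑< N g))

∑<-sucˡ : ∀ N (f : ℕ → ℕ) → ∑< (suc N) f ≡ f 0 + ∑< N (f ∘ suc)
∑<-sucˡ zero    f = refl
∑<-sucˡ (suc N) f = trans (cong (f (suc N) +_) (∑<-sucˡ N f)) (x∙yz≈y∙xz (f (suc N)) (f 0) _)

∑<-zeroTail : ∀ {N N′} (f : ℕ → ℕ) → N ≤ N′ → (∀ L → N ≤ L → f L ≡ 0) → ∑< N′ f ≡ ∑< N f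
∑<-zeroTail {N} f N≤N′ vanishes with m≤n⇒∃[o]m+o≡n N≤N′
... | d , refl = extend d
  where
  extend : ∀ d → ∑< (N + d) f ≡ ∑< N f
  extend zero    = cong (λ M → ∑< M f) (+-identityʳ N)
  extend (suc d) = begin
    ∑< (N + suc d) f          ≡⟨ cong (λ M → ∑< M f) (+-suc N d) ⟩
    f (N + d) + ∑< (N + d) f  ≡⟨ cong₂ _+_ (vanishes (N + d) (m≤m+n N d)) (extend d) ⟩
    ∑< N f                    ∎

count : (n : ℕ) → (Vec Bool n → Bool) → ℕ
count n p = length (filter (T? ∘ p) (allSubsets n))

length-filter-map : ∀ {A B : Set} (p : B → Bool) (f : A → B) (xs : List A) →
                    length (filter (T? ∘ p) (map f xs)) ≡ length (filter (T? ∘ p ∘ f) xs)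
length-filter-map p f []       = refl
length-filter-map p f (x ∷ xs) with p (f x)
... | true  = cong suc (length-filter-map p f xs)
... | false = length-filter-map p f xs

count-suc : ∀ n (p : Vec Bool (suc n) → Bool) →
            count (suc n) p ≡ count n (p ∘ (true ∷_)) + count n (p ∘ (false ∷_))
count-suc n p = begin
  length (filter P (map (true ∷_) vs ++ map (false ∷_) vs))
    ≡⟨ cong length (filter-++ P (map (true ∷_) vs) (map (false ∷_) vs)) ⟩
  length (filter P (map (true ∷_) vs) ++ filter P (map (false ∷_) vs))
    ≡⟨ length-++ (filter P (map (true ∷_) vs)) ⟩
  length (filter P (map (true ∷_) vs)) + length (filter P (map (false ∷_) vs))
    ≡⟨ cong₂ _+_ (length-filter-map p (true ∷_) vs) (length-filter-map p (false ∷_) vs) ⟩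
  count n (p ∘ (true ∷_)) + count n (p ∘ (false ∷_))
    ∎
  where
  P = T? ∘ p
  vs = allSubsets n

count-cong : ∀ {n} {p q : Vec Bool n → Bool} → (∀ v → p v ≡ q v) → count n p ≡ count n q
count-cong {n} {p} {q} p≗q = cong length
  (filter-≐ (T? ∘ p) (T? ∘ q) ((λ {v} → subst T (p≗q v)) , (λ {v} → subst T (sym (p≗q v)))) (allSubsets n))

count-false : ∀ {n} {p : Vec Bool n → Bool} → (∀ v → p v ≡ false) → count n p ≡ 0
count-false {n} {p} p≗false =
  cong length (filter-none (T? ∘ p) (universal (λ v → subst T (p≗false v)) (allSubsets n)))

last⁺ : ∀ {A : Set} {n} → A → Vec A n → A
last⁺ x []       = x
last⁺ _ (y ∷ ys) = last⁺ y ys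

-- The empty vector qualifies for r = 0: it is the tail of the singleton F = {nk}.
isTail : ∀ {n} → ℕ → Vec Bool n → Bool
isTail r v = (r ≡ᵇ countᵇ id v) ∧ last⁺ true v

tails : ℕ → ℕ → ℕ
tails L r = count L (isTail r)

tails-zero : ∀ r → tails 0 r ≡ (if r ≡ᵇ 0 then 1 else 0)
tails-zero zero    = refl
tails-zero (suc r) = refl

tails-suc-zero : ∀ L → tails (suc L) 0 ≡ 0
tails-suc-zero L = count-false {suc L} λ { (true ∷ v) → refl ; (false ∷ v) → noOnes⇒endsInZero v }
  where
  noOnes⇒endsInZero : ∀ {n} (v : Vec Bool n) → (0 ≡ᵇ countᵇ id v) ∧ last⁺ false v ≡ false
  noOnes⇒endsInZero []          = refl
  noOnes⇒endsInZero (true ∷ v)  = refl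
  noOnes⇒endsInZero (false ∷ v) = noOnes⇒endsInZero v

tails-pascal : ∀ L r → tails (suc (suc L)) r ≡ tails (suc L) r + tails (suc L) (r ∸ 1)
tails-pascal L r = begin
  tails (suc (suc L)) r
    ≡⟨ count-suc (suc L) (isTail r) ⟩
  count (suc L) (isTail r ∘ (true ∷_)) + count (suc L) (isTail r ∘ (false ∷_))
    ≡⟨ cong₂ _+_ (leadingOne r) (count-cong {suc L} λ { (c ∷ v) → refl }) ⟩
  tails (suc L) (r ∸ 1) + tails (suc L) r
    ≡⟨ +-comm (tails (suc L) (r ∸ 1)) (tails (suc L) r) ⟩
  tails (suc L) r + tails (suc L) (r ∸ 1)
    ∎
  where
  leadingOne : ∀ r → count (suc L) (isTail r ∘ (true ∷_)) ≡ tails (suc L) (r ∸ 1)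
  leadingOne zero    = trans (count-false {suc L} λ _ → refl) (sym (tails-suc-zero L))
  leadingOne (suc r) = refl

length-elemsFrom : ∀ k j {n} (v : Vec Bool n) → length (elemsFrom k j v) ≡ countᵇ id v
length-elemsFrom k j []          = refl
length-elemsFrom k j (true ∷ v)  = cong suc (length-elemsFrom k (suc j) v)
length-elemsFrom k j (false ∷ v) = length-elemsFrom k (suc j) v

elemsFrom-lowerBound : ∀ k {b} j {n} (v : Vec Bool n) → b ≤ j * k → All (b ≤_) (elemsFrom k j v)
elemsFrom-lowerBound k j []          b≤jk = []
elemsFrom-lowerBound k j (true ∷ v)  b≤jk =
  b≤jk ∷ elemsFrom-lowerBound k (suc j) v (≤-trans b≤jk (m≤n+m (j * k) k))
elemsFrom-lowerBound k j (false ∷ v) b≤jk =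
  elemsFrom-lowerBound k (suc j) v (≤-trans b≤jk (m≤n+m (j * k) k))

minL-lowerBound : ∀ {b xs} → All (b ≤_) xs → Maybe.All (b ≤_) (minL xs)
minL-lowerBound []                              = Maybe.nothing
minL-lowerBound {xs = x ∷ xs} (b≤x ∷ b≤xs) with minL xs | minL-lowerBound b≤xs
... | nothing | _              = Maybe.just b≤x
... | just m  | Maybe.just b≤m with x ≤ᵇ m
...   | true  = Maybe.just b≤x
...   | false = Maybe.just b≤m

minL-∷ : ∀ {x} xs → All (x ≤_) xs → minL (x ∷ xs) ≡ just x
minL-∷ {x} xs x≤xs with minL xs | minL-lowerBound x≤xs
... | nothing | _              = refl
... | just m  | Maybe.just x≤m with x ≤ᵇ m | ≤⇒≤ᵇ x≤m
...   | true | _ = refl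

isMaxSchreier-∷ : ∀ {x} xs → All (x ≤_) xs → isMaxSchreier (x ∷ xs) ≡ (x ≡ᵇ suc (length xs))
isMaxSchreier-∷ xs x≤xs rewrite minL-∷ xs x≤xs = refl

record AmRecurrence (k : ℕ) (g : ℕ → ℕ) : Set where
  field
    at-0     : g 0 ≡ (if k ≡ᵇ 1 then 1 else 0)
    at-1     : g 1 ≡ 0
    at-2     : g 2 ≡ 1
    vanishes : ∀ m → 3 ≤ m → m ≤ suc k → g m ≡ 0
    step     : ∀ m → suc k < m → g m ≡ g (m ∸ k) + g (m ∸ k ∸ 1)

am-unique : ∀ {k′ g} → AmRecurrence (suc k′) g → ∀ m → am (suc k′) m ≡ g m
am-unique {k′} {g} rec m = aFuel-solution (suc m) m ≤-refl
  where
  open AmRecurrence rec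
  aFuel-solution : ∀ f m → m < f → aFuel f (suc k′) m ≡ g m
  aFuel-solution (suc f) 0 _ = sym at-0
  aFuel-solution (suc f) 1 _ = sym at-1
  aFuel-solution (suc f) 2 _ = sym at-2
  aFuel-solution (suc f) m@(suc (suc (suc _))) m<1+f with m ≤ᵇ suc (suc k′) in m≤ᵇ2+k′
  ... | true  = sym (vanishes m (s≤s (s≤s (s≤s z≤n))) (≤ᵇ⇒≤ m _ (subst T (sym m≤ᵇ2+k′) tt)))
  ... | false = begin
    aFuel f (suc k′) (m ∸ suc k′) + aFuel f (suc k′) (m ∸ suc k′ ∸ 1)
      ≡⟨ cong₂ _+_ (aFuel-solution f _ m∸k<f) (aFuel-solution f _ (≤-<-trans (m∸n≤m _ 1) m∸k<f)) ⟩
    g (m ∸ suc k′) + g (m ∸ suc k′ ∸ 1)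
      ≡⟨ sym (step m (≰⇒> λ m≤2+k′ → subst T m≤ᵇ2+k′ (≤⇒≤ᵇ m≤2+k′))) ⟩
    g m
      ∎
    where
    m∸k<f : m ∸ suc k′ < f
    m∸k<f = ≤-trans (s≤s (m∸n≤m _ k′)) (≤-pred m<1+f)

module _ (k′ : ℕ) where

  -- Since k = suc k′, (suc i) * k ∸ 1 reduces to k′ + i * k; the index arithmetic relies on it.
  private
    k : ℕ
    k = suc k′

  -- v encodes a subset F of {(j+1)k, …, (j+n)k}.
  topSchreier : ∀ n → ℕ → Vec Bool n → Bool
  topSchreier n j v = let F = elemsFrom k (suc j) v in isMaxSchreier F ∧ memberᵇ ((j + n) * k) F

  member-top : ∀ j {n} b (v : Vec Bool n) →
               memberᵇ ((j + suc n) * k) (elemsFrom k (suc j) (b ∷ v)) ≡ last⁺ b v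
  member-top j true  [] rewrite +-comm j 1 = cong (_∨ false) (dec-true (suc j * k ≟ suc j * k) refl)
  member-top j false [] = refl
  member-top j {suc n} b (c ∷ v) rewrite +-suc j (suc n) = trans (skipHead b) (member-top (suc j) c v)
    where
    top = (suc j + suc n) * k
    skipHead : ∀ b → memberᵇ top (elemsFrom k (suc j) (b ∷ c ∷ v))
                   ≡ memberᵇ top (elemsFrom k (suc (suc j)) (c ∷ v))
    skipHead true  = cong (_∨ memberᵇ top (elemsFrom k (suc (suc j)) (c ∷ v)))
                            (dec-false (suc j * k ≟ top) (<⇒≢ (*-monoˡ-< k (m<m+n (suc j) z<s))))
    skipHead false = refl

  topSchreier-true∷ : ∀ n j (v : Vec Bool n) → topSchreier (suc n) j (true ∷ v) ≡ isTail (k′ + j * k) v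
  topSchreier-true∷ n j v = cong₂ _∧_ minIsSize (member-top j true v)
    where
    rest = elemsFrom k (suc (suc j)) v
    minIsSize : isMaxSchreier (suc j * k ∷ rest) ≡ (k′ + j * k ≡ᵇ countᵇ id v)
    minIsSize = trans (isMaxSchreier-∷ rest (elemsFrom-lowerBound k (suc (suc j)) v (m≤n+m (suc j * k) k)))
                      (cong (λ l → suc j * k ≡ᵇ suc l) (length-elemsFrom k (suc (suc j)) v))

  topSchreier-false∷ : ∀ n j (v : Vec Bool n) → topSchreier (suc n) j (false ∷ v) ≡ topSchreier n (suc j) v
  topSchreier-false∷ n j v = cong (λ t → isMaxSchreier F ∧ memberᵇ (t * k) F) (+-suc j n)
    where F = elemsFrom k (suc (suc j)) v

  top-∸-tail : ∀ n j → (j + suc n) * k ∸ 1 ∸ n * k ≡ k′ + j * k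
  top-∸-tail n j = begin
    (j + suc n) * k ∸ 1 ∸ n * k   ≡⟨ cong (λ t → t * k ∸ 1 ∸ n * k) (+-suc j n) ⟩
    k′ + (j + n) * k ∸ n * k      ≡⟨ cong (λ t → k′ + t ∸ n * k) (*-distribʳ-+ k j n) ⟩
    k′ + (j * k + n * k) ∸ n * k  ≡⟨ cong (_∸ n * k) (sym (+-assoc k′ (j * k) (n * k))) ⟩
    k′ + j * k + n * k ∸ n * k    ≡⟨ m+n∸n≡m (k′ + j * k) (n * k) ⟩
    k′ + j * k                    ∎

  count-topSchreier : ∀ n j → count n (topSchreier n j) ≡ ∑< n (λ L → tails L ((j + n) * k ∸ 1 ∸ L * k))
  count-topSchreier zero    j = refl
  count-topSchreier (suc n) j = begin
    count (suc n) (topSchreier (suc n) j)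
      ≡⟨ count-suc n (topSchreier (suc n) j) ⟩
    count n (topSchreier (suc n) j ∘ (true ∷_)) + count n (topSchreier (suc n) j ∘ (false ∷_))
      ≡⟨ cong₂ _+_ (count-cong (topSchreier-true∷ n j)) (count-cong (topSchreier-false∷ n j)) ⟩
    tails n (k′ + j * k) + count n (topSchreier n (suc j))
      ≡⟨ cong₂ _+_ (cong (tails n) (sym (top-∸-tail n j))) (count-topSchreier n (suc j)) ⟩
    tails n ((j + suc n) * k ∸ 1 ∸ n * k) + ∑< n (λ L → tails L ((suc j + n) * k ∸ 1 ∸ L * k))
      ≡⟨ cong (λ t → tails n ((j + suc n) * k ∸ 1 ∸ n * k) + ∑< n (λ L → tails L (t * k ∸ 1 ∸ L * k)))
              (sym (+-suc j n)) ⟩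
    ∑< (suc n) (λ L → tails L ((j + suc n) * k ∸ 1 ∸ L * k))
      ∎

  aSummand : ℕ → ℕ → ℕ
  aSummand m L = tails L (m + k′ ∸ L * k)

  aSum : ℕ → ℕ
  aSum m = ∑< (suc m) (aSummand m)

  sm-sum : ∀ n → sm k (suc n) ≡ ∑< (suc n) (aSummand (n * k))
  sm-sum n = trans (count-topSchreier (suc n) 0)
                   (∑<-cong (suc n) λ L → cong (λ t → tails L (t ∸ L * k)) (+-comm k′ (n * k)))

  aSummand-vanishes : ∀ m L → m ≤ suc (L * k) → aSummand m (suc L) ≡ 0
  aSummand-vanishes m L m≤1+Lk = trans (cong (tails (suc L)) (m≤n⇒m∸n≡0 m+k′≤k+Lk)) (tails-suc-zero L)
    where
    m+k′≤k+Lk : m + k′ ≤ suc L * k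
    m+k′≤k+Lk = ≤-trans (+-monoˡ-≤ k′ m≤1+Lk) (≤-reflexive (cong suc (+-comm (L * k) k′)))

  aSum-beyond : ∀ m N → m < N → ∑< N (aSummand m) ≡ aSum m
  aSum-beyond m N m<N = ∑<-zeroTail (aSummand m) m<N vanishes
    where
    vanishes : ∀ L → suc m ≤ L → aSummand m L ≡ 0
    vanishes (suc L) (s≤s m≤L) = aSummand-vanishes m L (≤-trans m≤L (≤-trans (m≤m*n L k) (n≤1+n _)))

  aSum-multiple : ∀ n → ∑< (suc n) (aSummand (n * k)) ≡ aSum (n * k)
  aSum-multiple n = sym (∑<-zeroTail (aSummand (n * k)) (s≤s (m≤m*n n k)) vanishes)
    where
    vanishes : ∀ L → suc n ≤ L → aSummand (n * k) L ≡ 0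
    vanishes (suc L) (s≤s n≤L) = aSummand-vanishes (n * k) L (≤-trans (*-monoˡ-≤ k n≤L) (n≤1+n _))

  aSum-small : ∀ m → m ≤ k → aSum (suc m) ≡ tails 1 m
  aSum-small m m≤k = begin
    aSum (suc m)                              ≡⟨ ∑<-zeroTail {2} {suc (suc m)} (aSummand (suc m)) (s≤s (s≤s z≤n)) vanishes ⟩
    tails 1 (m + k′ ∸ (k′ + 0)) + 0           ≡⟨ +-identityʳ _ ⟩
    tails 1 (m + k′ ∸ (k′ + 0))               ≡⟨ cong (λ t → tails 1 (m + k′ ∸ t)) (+-identityʳ k′) ⟩
    tails 1 (m + k′ ∸ k′)                     ≡⟨ cong (tails 1) (m+n∸n≡m m k′) ⟩
    tails 1 m                                 ∎
    where
    vanishes : ∀ L → 2 ≤ L → aSummand (suc m) L ≡ 0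
    vanishes (suc (suc L)) (s≤s (s≤s _)) = aSummand-vanishes (suc m) (suc L) (s≤s (≤-trans m≤k (m≤m+n k (L * k))))

  k+-∸-k+ : ∀ x y → k + x + k′ ∸ (k + y) ≡ x + k′ ∸ y
  k+-∸-k+ x y = begin
    k + x + k′ ∸ (k + y)    ≡⟨ ∸-+-assoc (k + x + k′) k y ⟨
    k + x + k′ ∸ k ∸ y      ≡⟨ cong (λ t → t ∸ k ∸ y) (+-assoc k x k′) ⟩
    k + (x + k′) ∸ k ∸ y    ≡⟨ cong (_∸ y) (m+n∸m≡n k (x + k′)) ⟩
    x + k′ ∸ y              ∎

  aSummand-pascal : ∀ d L → aSummand (k + suc (suc d)) (suc (suc L))
                          ≡ aSummand (suc (suc d)) (suc L) + aSummand (suc d) (suc L)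
  aSummand-pascal d L = begin
    tails (suc (suc L)) (k + suc (suc d) + k′ ∸ (k + suc L * k))
      ≡⟨ cong (tails (suc (suc L))) (k+-∸-k+ (suc (suc d)) (suc L * k)) ⟩
    tails (suc (suc L)) r
      ≡⟨ tails-pascal L r ⟩
    tails (suc L) r + tails (suc L) (r ∸ 1)
      ≡⟨ cong (λ t → tails (suc L) r + tails (suc L) t) pred-r ⟩
    tails (suc L) r + tails (suc L) (suc d + k′ ∸ suc L * k)
      ∎
    where
    r = suc (suc d) + k′ ∸ suc L * k
    pred-r : r ∸ 1 ≡ suc d + k′ ∸ suc L * k
    pred-r = trans (∸-+-assoc (suc (suc d) + k′) (suc L * k) 1)
                     (cong (suc (suc d) + k′ ∸_) (+-comm (suc L * k) 1))

  aSum-step′ : ∀ d → aSum (k + suc (suc d)) ≡ aSum (suc (suc d)) + aSum (suc d)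
  aSum-step′ d = begin
    ∑< (suc (suc N)) f
      ≡⟨ ∑<-sucˡ (suc N) f ⟩
    ∑< (suc N) (f ∘ suc)
      ≡⟨ ∑<-sucˡ N (f ∘ suc) ⟩
    f 1 + ∑< N (f ∘ suc ∘ suc)
      ≡⟨ cong₂ _+_ (cong (tails 1) (k+-∸-k+ (suc (suc d)) 0)) (∑<-cong N (aSummand-pascal d)) ⟩
    ∑< N (λ L → aSummand (suc (suc d)) (suc L) + aSummand (suc d) (suc L))
      ≡⟨ ∑<-+ N (aSummand (suc (suc d)) ∘ suc) (aSummand (suc d) ∘ suc) ⟩
    ∑< N (aSummand (suc (suc d)) ∘ suc) + ∑< N (aSummand (suc d) ∘ suc)
      ≡⟨ cong₂ _+_ (∑<-sucˡ N (aSummand (suc (suc d)))) (∑<-sucˡ N (aSummand (suc d))) ⟨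
    ∑< (suc N) (aSummand (suc (suc d))) + ∑< (suc N) (aSummand (suc d))
      ≡⟨ cong₂ _+_ (aSum-beyond (suc (suc d)) (suc N) (s≤s (m≤n+m (suc (suc d)) k′)))
                   (aSum-beyond (suc d) (suc N) (s≤s (≤-trans (n≤1+n (suc d)) (m≤n+m (suc (suc d)) k′)))) ⟩
    aSum (suc (suc d)) + aSum (suc d)
      ∎
    where
    N = k′ + suc (suc d)
    f = aSummand (k + suc (suc d))

  aSum-step : ∀ m → suc k < m → aSum m ≡ aSum (m ∸ k) + aSum (m ∸ k ∸ 1)
  aSum-step m 1+k<m with m≤n⇒∃[o]m+o≡n 1+k<m
  ... | d , refl = begin
    aSum (2 + k + d)                          ≡⟨ cong aSum 2+k+d≡k+[2+d] ⟩
    aSum (k + (2 + d))                        ≡⟨ aSum-step′ d ⟩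
    aSum (2 + d) + aSum (1 + d)               ≡⟨ cong (λ t → aSum t + aSum (t ∸ 1)) 2+k+d∸k≡2+d ⟨
    aSum (2 + k + d ∸ k) + aSum (2 + k + d ∸ k ∸ 1) ∎
    where
    2+k+d≡k+[2+d] : 2 + k + d ≡ k + (2 + d)
    2+k+d≡k+[2+d] = sym (trans (+-suc k (suc d)) (cong suc (+-suc k d)))
    2+k+d∸k≡2+d : 2 + k + d ∸ k ≡ 2 + d
    2+k+d∸k≡2+d = trans (cong (_∸ k) 2+k+d≡k+[2+d]) (m+n∸m≡n k (2 + d))

  aSum-recurrence : AmRecurrence k aSum
  aSum-recurrence = record
    { at-0     = trans (+-identityʳ (tails 0 k′)) (tails-zero k′)
    ; at-1     = aSum-small 0 z≤n
    ; at-2     = aSum-small 1 (s≤s z≤n)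
    ; vanishes = λ { (suc m) (s≤s (s≤s (s≤s _))) (s≤s m≤k) → aSum-small m m≤k }
    ; step     = aSum-step
    }

theorem1p2 : (k n : ℕ) → k ≥ 1 → n ≥ 1 → sm k n ≡ am k ((n ∸ 1) * k)
theorem1p2 (suc k′) (suc n) _ _ = begin
  sm (suc k′) (suc n)                    ≡⟨ sm-sum k′ n ⟩
  ∑< (suc n) (aSummand k′ (n * suc k′))  ≡⟨ aSum-multiple k′ n ⟩
  aSum k′ (n * suc k′)                   ≡⟨ am-unique (aSum-recurrence k′) (n * suc k′) ⟨
  am (suc k′) (n * suc k′)               ∎
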